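{- A finite simple graph $G$ admits a link-irregular labeling if and only if for all distinct $x,y\in V(G)$, at least one of the following holds: (a) $L(x)\not\cong L(y)$; or (b) both (i) $N_a(x)\neq N_a(y)$, and (ii) for each integer $n\ge 0$, at most one vertex $w\in V(G)$ satisfies $L(w)\cong \overline{K}_n$.
   Context: All graphs are finite and simple. For a vertex $v$ of $G$, its link is $L(v)=G[N(v)]$. The active neighborhood of $x$ is $N_a(x)=\{u\in N(x): \deg_{G[N(x)]}(u)\ge 1\}$, the set of neighbors of $x$ that are not isolated in $L(x)$. $\overline{K}_n$ denotes the edgeless graph on $n$ vertices. An edge-labeling is a map $l:E(G)\to\mathbb{Z}^+$; the labeled link $L_l(v)$ is $L(v)$ with edges carrying their labels; labeled graphs are isomorphic if there is a label-preserving graph isomorphism. The labeling $l$ is link-irregular if $L_l(u)\not\cong L_l(v)$ for all distinct $u,v\in V(G)$. -}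

module Defs where

open import Data.Nat using (ℕ; _≤_)
open import Data.Fin using (Fin)
open import Data.Bool using (Bool; true; false)
open import Data.Product using (Σ; ∃; _×_; _,_; proj₁)
open import Data.Empty using (⊥)
open import Relation.Nullary using (¬_)
open import Relation.Binary.PropositionalEquality using (_≡_; _≢_)
open import Function.Bundles using (_⤖_; _⇔_; Bijection)

record Graph : Set where
  field
    n     : ℕ
    adj   : Fin n → Fin n → Bool
    sym   : ∀ x y → adj x y ≡ adj y x
    irref : ∀ x → adj x x ≡ false

record AGraph : Set₁ where
  field
    V : Set
    E : V → V → Bool

record LAGraph : Set₁ where
  field
    V   : Set
    E   : V → V → Bool
    lab : V → V → ℕ   -- label of an edge (only meaningful where E holds)

_≅_ : AGraph → AGraph → Set
A ≅ B = Σ (AGraph.V A ⤖ AGraph.V B) λ f →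
  ∀ a b → AGraph.E A a b ≡ AGraph.E B (Bijection.to f a) (Bijection.to f b)

_≅ₗ_ : LAGraph → LAGraph → Set
A ≅ₗ B = Σ (LAGraph.V A ⤖ LAGraph.V B) λ f →
  (∀ a b → LAGraph.E A a b ≡ LAGraph.E B (Bijection.to f a) (Bijection.to f b)) ×
  (∀ a b → LAGraph.E A a b ≡ true →
     LAGraph.lab A a b ≡ LAGraph.lab B (Bijection.to f a) (Bijection.to f b))

K̄ : ℕ → AGraph
K̄ m = record { V = Fin m ; E = λ _ _ → false }

module _ (G : Graph) where
  open Graph G

  Nbr : Fin n → Set
  Nbr v = Σ (Fin n) λ w → adj v w ≡ true

  L : Fin n → AGraph
  L v = record { V = Nbr v ; E = λ a b → adj (proj₁ a) (proj₁ b) }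

  -- Edge labeling l : E(G) → ℤ⁺, given as a symmetric function on vertex pairs
  -- (values on non-edges are irrelevant), positive on every edge.
  record Labeling : Set where
    field
      lab  : Fin n → Fin n → ℕ
      symm : ∀ x y → lab x y ≡ lab y x
      pos  : ∀ x y → adj x y ≡ true → 1 ≤ lab x y

  Lₗ : Labeling → Fin n → LAGraph
  Lₗ l v = record { V = Nbr v ; E = λ a b → adj (proj₁ a) (proj₁ b)
                  ; lab = λ a b → Labeling.lab l (proj₁ a) (proj₁ b) }

  LinkIrregular : Labeling → Set
  LinkIrregular l = ∀ u v → u ≢ v → ¬ (Lₗ l u ≅ₗ Lₗ l v)

  -- u ∈ N_a(x): u is a neighbour of x not isolated in L(x).
  InNa : Fin n → Fin n → Set
  InNa x u = adj x u ≡ true × ∃ λ w → adj x w ≡ true × adj u w ≡ true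

  SameNa : Fin n → Fin n → Set
  SameNa x y = ∀ u → InNa x u ⇔ InNa y u

{-# OPTIONS --safe #-}
-- Sufficiency: label the edges injectively as unordered pairs. A labeled isomorphism
-- L_l(u) ≅ L_l(v) must then send every edge {a, b} of L(u) to the edge {a, b} of L(v),
-- so N_a(u) = N_a(v); forgetting labels also gives L(u) ≅ L(v).
-- Necessity: if N_a(x) = N_a(y), an isomorphism L(x) ≅ L(y) can be modified to fix
-- every non-isolated vertex of L(x) and permute the isolated ones; every edge of L(x)
-- joins two fixed vertices, so the result respects any labeling. Edgeless links carry
-- no labels, so two of them of the same order are isomorphic as labeled links.
module Submission where

open import Defs
open import Data.Nat using (ℕ)
open import Data.Fin using (Fin)
open import Data.Product using (∃; _×_)
open import Data.Sum using (_⊎_)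
open import Relation.Nullary using (¬_)
open import Relation.Binary.PropositionalEquality using (_≡_; _≢_)
open import Function.Bundles using (_⇔_)

open import Axiom.UniquenessOfIdentityProofs using (module Decidable⇒UIP)
open import Data.Bool using (true; false) renaming (_≟_ to _≟ᵇ_)
open import Data.Bool.Properties using (¬-not)
open import Data.Fin using (toℕ; combine)
open import Data.Fin.Properties
  using (_≟_; _≤?_; ≤-antisym; ≤-total; toℕ-injective; combine-injective; any?; all?)
open import Data.Nat using (suc; s≤s; z≤n)
open import Data.Nat.Properties using (suc-injective)
open import Data.Product using (_,_; proj₁; proj₂; uncurry; swap)
open import Data.Product.Properties using (,-injectiveˡ; ,-injectiveʳ)
open import Data.Sum using (inj₁; inj₂; [_,_]′)
open import Function using (_∘_)
open import Function.Bundles using (_⤖_; Bijection; Surjection; Equivalence; mk⇔; mk⤖)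
open import Function.Construct.Composition using (_⤖-∘_)
open import Function.Construct.Symmetry using (⤖-sym)
open import Function.Consequences.Propositional using (strictlySurjective⇒surjective)
open import Relation.Nullary using (Dec; yes; no; contradiction)
open import Relation.Nullary.Decidable using (map′; _×-dec_; _→-dec_; decidable-stable)
open import Relation.Binary.PropositionalEquality using (refl; sym; trans; cong; cong₂; subst)

_⇔-dec_ : {A B : Set} → Dec A → Dec B → Dec (A ⇔ B)
a? ⇔-dec b? = map′ (uncurry mk⇔) (λ e → Equivalence.to e , Equivalence.from e)
                   ((a? →-dec b?) ×-dec (b? →-dec a?))

module _ {A B : AGraph} where
  open AGraph

  ≅-sym : A ≅ B → B ≅ A
  ≅-sym (φ , φ-E) = ⤖-sym φ , λ b b′ →
    sym (trans (φ-E (to⁻ b) (to⁻ b′)) (cong₂ (E B) (to∘to⁻ b) (to∘to⁻ b′)))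
    where open Surjection (Bijection.surjection φ) using (to⁻; to∘to⁻)

  ≅-trans : ∀ {C} → A ≅ B → B ≅ C → A ≅ C
  ≅-trans (φ , φ-E) (ψ , ψ-E) = ψ ⤖-∘ φ , λ a a′ →
    trans (φ-E a a′) (ψ-E (Bijection.to φ a) (Bijection.to φ a′))

NonIsolated : (A : AGraph) → AGraph.V A → Set
NonIsolated A a = ∃ λ b → AGraph.E A a b ≡ true

isolated⇒nonadjacent : ∀ {A a} → ¬ NonIsolated A a → ∀ b → AGraph.E A a b ≡ false
isolated⇒nonadjacent isolated b = ¬-not (λ ab → isolated (b , ab))

≅-nonIsolated : ∀ {A B} ((φ , _) : A ≅ B) a → NonIsolated A a ⇔ NonIsolated B (Bijection.to φ a)
≅-nonIsolated {B = B} (φ , φ-E) a = mk⇔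
  (λ (b , ab) → to b , trans (sym (φ-E a b)) ab)
  (λ (b , e) → to⁻ b , trans (φ-E a (to⁻ b)) (trans (cong (AGraph.E B (to a)) (to∘to⁻ b)) e))
  where open Surjection (Bijection.surjection φ) using (to; to⁻; to∘to⁻)

forget : LAGraph → AGraph
forget A = record { V = LAGraph.V A ; E = LAGraph.E A }

≅ₗ-sym : ∀ {A B} → A ≅ₗ B → B ≅ₗ A
≅ₗ-sym {A} {B} (φ , φ-E , φ-lab) =
  let (φ⁻¹ , φ⁻¹-E) = ≅-sym {forget A} {forget B} (φ , φ-E)
  in φ⁻¹ , φ⁻¹-E , λ b b′ bb′ →
       sym (trans (φ-lab (to⁻ b) (to⁻ b′) (trans (sym (φ⁻¹-E b b′)) bb′))
                  (cong₂ (LAGraph.lab B) (to∘to⁻ b) (to∘to⁻ b′)))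
  where open Surjection (Bijection.surjection φ) using (to⁻; to∘to⁻)

module _ (G : Graph) where
  open Graph G renaming (sym to adj-sym)

  EdgelessLinksUnique : Set
  EdgelessLinksUnique = ∀ (m : ℕ) (w w′ : Fin n) → L G w ≅ K̄ m → L G w′ ≅ K̄ m → w ≡ w′

  IrregularityCondition : Set
  IrregularityCondition =
    ∀ (x y : Fin n) → x ≢ y → ¬ (L G x ≅ L G y) ⊎ (¬ SameNa G x y × EdgelessLinksUnique)

  Nbr-≡ : ∀ {v} {a b : Nbr G v} → proj₁ a ≡ proj₁ b → a ≡ b
  Nbr-≡ {a = w , p} {b = .w , q} refl = cong (w ,_) (Decidable⇒UIP.≡-irrelevant _≟ᵇ_ p q)

  commonNbr? : ∀ x u → Dec (∃ λ w → adj x w ≡ true × adj u w ≡ true)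
  commonNbr? x u = any? λ w → (adj x w ≟ᵇ true) ×-dec (adj u w ≟ᵇ true)

  sameNa? : ∀ x y → Dec (SameNa G x y)
  sameNa? x y = all? λ u → inNa? x u ⇔-dec inNa? y u
    where
    inNa? : ∀ x u → Dec (InNa G x u)
    inNa? x u = (adj x u ≟ᵇ true) ×-dec commonNbr? x u

  activeNbr : ∀ {x u} → InNa G x u → Nbr G x
  activeNbr {u = u} (xu , _) = u , xu

  activeNbr-nonIsolated : ∀ {x u} (i : InNa G x u) → NonIsolated (L G x) (activeNbr i)
  activeNbr-nonIsolated (_ , w , xw , uw) = (w , xw) , uw

  nonIsolated⇒InNa : ∀ {x} (a : Nbr G x) → NonIsolated (L G x) a → InNa G x (proj₁ a)
  nonIsolated⇒InNa (_ , xa) ((w , xw) , aw) = xa , w , xw , aw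

  nonIsolated? : ∀ {x} (a : Nbr G x) → Dec (NonIsolated (L G x) a)
  nonIsolated? {x} (u , xu) =
    map′ (activeNbr-nonIsolated ∘ (xu ,_)) (proj₂ ∘ nonIsolated⇒InNa (u , xu)) (commonNbr? x u)

  isolated⇒nonadjacentʳ : ∀ {x} (b : Nbr G x) → ¬ NonIsolated (L G x) b →
                          ∀ a → adj (proj₁ a) (proj₁ b) ≡ false
  isolated⇒nonadjacentʳ {x} b isolated a =
    trans (adj-sym (proj₁ a) (proj₁ b)) (isolated⇒nonadjacent {L G x} {b} isolated a)

  module Relink {x y : Fin n} (same : SameNa G x y) (φ : L G x ≅ L G y) where
    open Bijection (proj₁ φ) using (to; injective)
    open Surjection (Bijection.surjection (proj₁ φ)) using (to⁻; to∘to⁻)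

    active-in-y : ∀ a → NonIsolated (L G x) a → InNa G y (proj₁ a)
    active-in-y a active = Equivalence.to (same (proj₁ a)) (nonIsolated⇒InNa a active)

    relink : Nbr G x → Nbr G y
    relink a with nonIsolated? a
    ... | yes active = activeNbr (active-in-y a active)
    ... | no _       = to a

    relink-active : ∀ {a} → NonIsolated (L G x) a → proj₁ (relink a) ≡ proj₁ a
    relink-active {a} active with nonIsolated? a
    ... | yes _       = refl
    ... | no isolated = contradiction active isolated

    relink-isolated : ∀ {a} → ¬ NonIsolated (L G x) a → relink a ≡ to a
    relink-isolated {a} isolated with nonIsolated? a
    ... | yes active = contradiction active isolated
    ... | no _       = refl

    relink-nonIsolated : ∀ a → NonIsolated (L G x) a ⇔ NonIsolated (L G y) (relink a)
    relink-nonIsolated a with nonIsolated? a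
    ... | yes active  = mk⇔ (λ _ → activeNbr-nonIsolated (active-in-y a active)) (λ _ → active)
    ... | no isolated = mk⇔ (λ active → contradiction active isolated)
                            (Equivalence.from (≅-nonIsolated {L G x} {L G y} φ a))

    relink-injective : ∀ {a b} → relink a ≡ relink b → a ≡ b
    relink-injective {a} {b} e = by-cases (nonIsolated? a) (nonIsolated? b)
      where
      transfer : ∀ {c d} → relink c ≡ relink d → NonIsolated (L G x) c → NonIsolated (L G x) d
      transfer {c} {d} e = Equivalence.from (relink-nonIsolated d)
                         ∘ subst (NonIsolated (L G y)) e
                         ∘ Equivalence.to (relink-nonIsolated c)

      by-cases : Dec (NonIsolated (L G x) a) → Dec (NonIsolated (L G x) b) → a ≡ b
      by-cases (yes α) (yes β) =
        Nbr-≡ (trans (sym (relink-active α)) (trans (cong proj₁ e) (relink-active β)))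
      by-cases (no α)  (no β)  =
        injective (trans (sym (relink-isolated α)) (trans e (relink-isolated β)))
      by-cases (yes α) (no β)  = contradiction (transfer e α) β
      by-cases (no α)  (yes β) = contradiction (transfer (sym e) β) α

    relink-strictlySurjective : ∀ v → ∃ λ a → relink a ≡ v
    relink-strictlySurjective v with nonIsolated? v
    ... | yes active =
      let i = Equivalence.from (same (proj₁ v)) (nonIsolated⇒InNa v active)
      in activeNbr i , Nbr-≡ (relink-active (activeNbr-nonIsolated i))
    ... | no isolated = to⁻ v , trans (relink-isolated preimage-isolated) (to∘to⁻ v)
      where
      preimage-isolated : ¬ NonIsolated (L G x) (to⁻ v)
      preimage-isolated = isolated
                        ∘ subst (NonIsolated (L G y)) (to∘to⁻ v)
                        ∘ Equivalence.to (≅-nonIsolated {L G x} {L G y} φ (to⁻ v))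

    relink-adj : ∀ a b → adj (proj₁ a) (proj₁ b) ≡ adj (proj₁ (relink a)) (proj₁ (relink b))
    relink-adj a b = by-cases (nonIsolated? a) (nonIsolated? b)
      where
      by-cases : Dec (NonIsolated (L G x) a) → Dec (NonIsolated (L G x) b) →
                 adj (proj₁ a) (proj₁ b) ≡ adj (proj₁ (relink a)) (proj₁ (relink b))
      by-cases (yes α) (yes β) = sym (cong₂ adj (relink-active α) (relink-active β))
      by-cases (no α)  _       =
        trans (isolated⇒nonadjacent {L G x} {a} α b)
              (sym (isolated⇒nonadjacent {L G y} {relink a}
                      (α ∘ Equivalence.from (relink-nonIsolated a)) (relink b)))
      by-cases (yes _) (no β)  =
        trans (isolated⇒nonadjacentʳ b β a)
              (sym (isolated⇒nonadjacentʳ (relink b)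
                      (β ∘ Equivalence.from (relink-nonIsolated b)) (relink a)))

    relink-lab : (l : Labeling G) → ∀ a b → adj (proj₁ a) (proj₁ b) ≡ true →
                 Labeling.lab l (proj₁ a) (proj₁ b) ≡
                 Labeling.lab l (proj₁ (relink a)) (proj₁ (relink b))
    relink-lab l a b ab = sym (cong₂ (Labeling.lab l)
      (relink-active (b , ab))
      (relink-active (a , trans (adj-sym (proj₁ b) (proj₁ a)) ab)))

    relink-⤖ : Nbr G x ⤖ Nbr G y
    relink-⤖ = mk⤖ (relink-injective , strictlySurjective⇒surjective relink-strictlySurjective)

  sameNa-≅⇒≅ₗ : (l : Labeling G) {x y : Fin n} →
                SameNa G x y → L G x ≅ L G y → Lₗ G l x ≅ₗ Lₗ G l y
  sameNa-≅⇒≅ₗ l same φ = relink-⤖ , relink-adj , relink-lab l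
    where open Relink same φ

  edgeless-≅ₗ : (l : Labeling G) {m : ℕ} {w w′ : Fin n} →
                L G w ≅ K̄ m → L G w′ ≅ K̄ m → Lₗ G l w ≅ₗ Lₗ G l w′
  edgeless-≅ₗ l {m} {w} {w′} φ ψ =
    proj₁ χ , proj₂ χ , λ a b ab → contradiction (trans (sym ab) (proj₂ φ a b)) λ ()
    where
    χ : L G w ≅ L G w′
    χ = ≅-trans {L G w} {K̄ m} {L G w′} φ (≅-sym {L G w′} ψ)

  linkIrregular⇒edgelessLinksUnique : (l : Labeling G) → LinkIrregular G l → EdgelessLinksUnique
  linkIrregular⇒edgelessLinksUnique l irregular m w w′ φ ψ =
    decidable-stable (w ≟ w′) λ w≢w′ → irregular w w′ w≢w′ (edgeless-≅ₗ l φ ψ)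

  sort₂ : Fin n → Fin n → Fin n × Fin n
  sort₂ u v with u ≤? v
  ... | yes _ = u , v
  ... | no _  = v , u

  sort₂-comm : ∀ u v → sort₂ u v ≡ sort₂ v u
  sort₂-comm u v with u ≤? v | v ≤? u
  ... | yes u≤v | yes v≤u = cong₂ _,_ (≤-antisym u≤v v≤u) (≤-antisym v≤u u≤v)
  ... | yes _   | no _    = refl
  ... | no _    | yes _   = refl
  ... | no u≰v  | no v≰u  = contradiction (≤-total u v) [ u≰v , v≰u ]′

  sort₂-injective : ∀ {a b c d} → sort₂ a b ≡ sort₂ c d → (a ≡ c × b ≡ d) ⊎ (a ≡ d × b ≡ c)
  sort₂-injective {a} {b} {c} {d} e with a ≤? b | c ≤? d
  ... | yes _ | yes _ = inj₁ (,-injectiveˡ e , ,-injectiveʳ e)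
  ... | yes _ | no _  = inj₂ (,-injectiveˡ e , ,-injectiveʳ e)
  ... | no _  | yes _ = inj₂ (swap (,-injectiveˡ e , ,-injectiveʳ e))
  ... | no _  | no _  = inj₁ (swap (,-injectiveˡ e , ,-injectiveʳ e))

  pairLabel : Fin n → Fin n → ℕ
  pairLabel u v = suc (toℕ (uncurry combine (sort₂ u v)))

  pairLabel-injective : ∀ {a b c d} → pairLabel a b ≡ pairLabel c d →
                        (a ≡ c × b ≡ d) ⊎ (a ≡ d × b ≡ c)
  pairLabel-injective {a} {b} {c} {d} e =
    let (min≡ , max≡) = combine-injective _ _ _ _ (toℕ-injective (suc-injective e))
    in sort₂-injective {a} {b} {c} {d} (cong₂ _,_ min≡ max≡)

  pairLabeling : Labeling G
  pairLabeling = record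
    { lab  = pairLabel
    ; symm = λ u v → cong (suc ∘ toℕ ∘ uncurry combine) (sort₂-comm u v)
    ; pos  = λ _ _ _ → s≤s z≤n
    }

  pairLabel-edge⇒InNa : ∀ {v t w} (a b : Nbr G v) → adj (proj₁ a) (proj₁ b) ≡ true →
                        pairLabel (proj₁ a) (proj₁ b) ≡ pairLabel t w → InNa G v t
  pairLabel-edge⇒InNa {t = t} {w} (a , va) (b , vb) ab e
    with pairLabel-injective {a} {b} {t} {w} e
  ... | inj₁ (refl , refl) = va , b , vb , ab
  ... | inj₂ (refl , refl) = vb , a , va , trans (adj-sym b a) ab

  pairLabeling-≅ₗ⇒InNa : ∀ {u v} → Lₗ G pairLabeling u ≅ₗ Lₗ G pairLabeling v →
                         ∀ t → InNa G u t → InNa G v t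
  pairLabeling-≅ₗ⇒InNa (φ , φ-E , φ-lab) t (ut , w , uw , tw) =
    pairLabel-edge⇒InNa (to (t , ut)) (to (w , uw))
      (trans (sym (φ-E (t , ut) (w , uw))) tw) (sym (φ-lab (t , ut) (w , uw) tw))
    where open Bijection φ using (to)

  pairLabeling-≅ₗ⇒SameNa : ∀ {u v} → Lₗ G pairLabeling u ≅ₗ Lₗ G pairLabeling v → SameNa G u v
  pairLabeling-≅ₗ⇒SameNa {u} {v} iso t = mk⇔
    (pairLabeling-≅ₗ⇒InNa iso t)
    (pairLabeling-≅ₗ⇒InNa (≅ₗ-sym {Lₗ G pairLabeling u} {Lₗ G pairLabeling v} iso) t)

  pairLabeling-linkIrregular : (∀ u v → u ≢ v → ¬ (L G u ≅ L G v) ⊎ ¬ SameNa G u v) →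
                               LinkIrregular G pairLabeling
  pairLabeling-linkIrregular distinguishable u v u≢v iso@(φ , φ-E , _) =
    [ (λ ¬≅ → ¬≅ (φ , φ-E)) , (λ ¬same → ¬same (pairLabeling-≅ₗ⇒SameNa iso)) ]′
      (distinguishable u v u≢v)

mainTheorem2 : (G : Graph) →
    (∃ λ (l : Labeling G) → LinkIrregular G l) ⇔
    (∀ (x y : Fin (Graph.n G)) → x ≢ y →
      ¬ (L G x ≅ L G y) ⊎
      (¬ SameNa G x y ×
       (∀ (m : ℕ) (w w′ : Fin (Graph.n G)) → L G w ≅ K̄ m → L G w′ ≅ K̄ m → w ≡ w′)))
mainTheorem2 G = mk⇔ necessary sufficient
  where
  necessary : (∃ λ (l : Labeling G) → LinkIrregular G l) → IrregularityCondition G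
  necessary (l , irregular) x y x≢y with sameNa? G x y
  ... | yes same = inj₁ λ φ → irregular x y x≢y (sameNa-≅⇒≅ₗ G l same φ)
  ... | no ¬same = inj₂ (¬same , linkIrregular⇒edgelessLinksUnique G l irregular)

  sufficient : IrregularityCondition G → ∃ λ (l : Labeling G) → LinkIrregular G l
  sufficient condition = pairLabeling G , pairLabeling-linkIrregular G λ u v u≢v →
    [ inj₁ , inj₂ ∘ proj₁ ]′ (condition u v u≢v)
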